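{- Let $e \geq 1$ and let $k_1, \ldots, k_e$ be integers with $k_i \geq 2$ for all $i$. Put $A = k_e k_{e-1} \cdots k_1$ and $B = k_e k_{e-1}\cdots k_2 + k_e k_{e-1} \cdots k_3 + \cdots + k_e k_{e-1} + k_e$, i.e. $B = \sum_{j=2}^{e} \prod_{i=j}^{e} k_i$. If $p_y$ is an integer with $p_y \geq 3 \cdot 2^e$, then $A p_y - B$ does not divide $p_y^2 + p_y + 1$. -}

module Defs where

open import Data.Nat using (ℕ; zero; suc; _≤_; _<_)
open import Data.Integer using (ℤ; _*_; _+_; +_)

-- prod k j e = k j * k (j+1) * ... * k e   (empty product = 1 when e < j)
-- defined via the number of factors m = e - j + 1:  prodN k j m = k j * ... * k (j + m - 1)
prodN : (ℕ → ℤ) → ℕ → ℕ → ℤ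
prodN k j zero    = + 1
prodN k j (suc m) = k j * prodN k (suc j) m

-- ∏_{i=j}^{e} k_i, for 1 ≤ j ≤ e+1 ; uses m = e + 1 - j factors
prodFromTo : (ℕ → ℤ) → ℕ → ℕ → ℤ
prodFromTo k j e = prodN k j (suc e Data.Nat.∸ j)

Aof : (ℕ → ℤ) → ℕ → ℤ
Aof k e = prodFromTo k 1 e

-- sumB k j e = Σ_{j' = j}^{e} ∏_{i=j'}^{e} k_i, with n = number of summands
sumN : (ℕ → ℤ) → ℕ → ℕ → ℕ → ℤ
sumN k e j zero    = + 0
sumN k e j (suc n) = prodFromTo k j e + sumN k e (suc j) n

Bof : (ℕ → ℤ) → ℕ → ℤ
Bof k e = sumN k e 2 (e Data.Nat.∸ 1)

module Submission where

-- (1) Size: for a product A of n factors ≥ 2 and the sum B of its proper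
--     tails one has 0 ≤ B < A and A ≤ 2ⁿ·(A − B) (record TailBounds).  The
--     bounds survive prepending a factor K ≥ 2, which sends (A , B) to
--     (K·A , A + B), so they hold for every tail k_j⋯k_e by induction on the
--     number of factors (tailBounds).
-- (2) Elimination of p²:  A·(p² + p + 1) − (p + 1)·(A·p − B) = B·p + A + B,
--     so a divisor d = A·p − B of p² + p + 1 also divides X = B·p + A + B
--     (divides-linear).
--
-- For p ≥ 3·2ⁿ the bounds of (1) give 0 < X < d, impossible for a multiple X
-- of d (not-divisor); the theorem is the case of the full product.  Every
-- inequality between integers is proved by writing the gap between its sides
-- as a sum of products of quantities already known to be nonnegative; the
-- polynomial identity behind it is checked by the ring solver.

open import Defs
open import Data.Nat using (ℕ; _^_)
open import Data.Integer using (ℤ; +_; _*_; _+_; _-_; _≤_)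
open import Data.Integer.Divisibility using (_∣_)
open import Relation.Nullary using (¬_)

import Data.Nat as ℕ
import Data.Nat.Properties as ℕ
open import Data.Nat.Divisibility using (>⇒∤)
open import Data.Integer using (_<_; 0ℤ; +≤+; +<+)
open import Data.Integer.Properties
  using (+-identityʳ; +-mono-≤; +-monoʳ-≤; pos-*; i≤j⇒0≤j-i; i<j⇒suc[i]≤j; suc[i]≤j⇒i<j)
import Data.Integer.Divisibility.Signed as Signed
open import Data.Integer.Tactic.RingSolver using (solve-∀)
open import Relation.Binary.PropositionalEquality using (_≡_; refl; sym; trans; cong; subst; subst₂)

0≤+ : ∀ n → 0ℤ ≤ + n
0≤+ n = +≤+ ℕ.z≤n

0≤-* : ∀ {a b} → 0ℤ ≤ a → 0ℤ ≤ b → 0ℤ ≤ a * b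
0≤-* {+ m} {+ n} _ _ = subst (0ℤ ≤_) (pos-* m n) (0≤+ (m ℕ.* n))

≤-byGap : ∀ {x y} g → y ≡ x + g → 0ℤ ≤ g → x ≤ y
≤-byGap {x} g y≡x+g 0≤g = subst₂ _≤_ (+-identityʳ x) (sym y≡x+g) (+-monoʳ-≤ x 0≤g)

<-byGap : ∀ {x y} g → y ≡ + 1 + x + g → 0ℤ ≤ g → x < y
<-byGap g eq 0≤g = suc[i]≤j⇒i<j (≤-byGap g eq 0≤g)

gap< : ∀ {x y} → x < y → 0ℤ ≤ y - (+ 1 + x)
gap< x<y = i≤j⇒0≤j-i (i<j⇒suc[i]≤j x<y)

record TailBounds (n : ℕ) (A B : ℤ) : Set where
  field
    tails-nonneg : 0ℤ ≤ B
    tails-below  : B < A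
    ratio-bound  : A ≤ + (2 ^ n) * (A - B)
open TailBounds

tailBounds-one : ∀ {K} → + 2 ≤ K → TailBounds 1 (K * + 1) 0ℤ
tailBounds-one {K} 2≤K = record
  { tails-nonneg = 0≤+ 0
  ; tails-below  = <-byGap _ (below-gap K) (+-mono-≤ 0≤u (0≤+ 1))
  ; ratio-bound  = ≤-byGap _ (ratio-gap K) (+-mono-≤ 0≤u (0≤+ 2))
  }
  where
  below-gap : ∀ K → K * + 1 ≡ + 1 + 0ℤ + (K - + 2 + + 1)
  below-gap = solve-∀
  ratio-gap : ∀ K → + 2 * (K * + 1 - 0ℤ) ≡ K * + 1 + (K - + 2 + + 2)
  ratio-gap = solve-∀
  0≤u : 0ℤ ≤ K - + 2
  0≤u = i≤j⇒0≤j-i 2≤K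

tailBounds-step : ∀ {n K A B} → + 2 ≤ K → TailBounds n A B →
                  TailBounds (ℕ.suc n) (K * A) (A + B)
tailBounds-step {n} {K} {A} {B} 2≤K bounds = record
  { tails-nonneg = ≤-byGap _ (nonneg-gap A B) (+-mono-≤ (+-mono-≤ (+-mono-≤ 0≤B 0≤B) (0≤+ 1)) 0≤c)
  ; tails-below  = <-byGap _ (below-gap K A B) (+-mono-≤ (0≤-* 0≤u 0≤A) 0≤c)
  ; ratio-bound  = subst (λ t → K * A ≤ t * (K * A - (A + B))) (sym (pos-* 2 (2 ^ n)))
      (≤-byGap _ (ratio-gap K A B t)
        (+-mono-≤ (0≤-* (0≤-* 0≤u 0≤A) (+-mono-≤ (0≤-* (0≤+ 2) 0≤t-1) (0≤+ 1))) (0≤-* (0≤+ 2) 0≤r)))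
  }
  where
  -- The certificates use the gaps u = K − 2, c = A − B − 1, r = 2ⁿ(A − B) − A
  -- and 2ⁿ − 1, all nonnegative.
  A-gap : ∀ A B → A ≡ 0ℤ + (B + + 1 + (A - (+ 1 + B)))
  A-gap = solve-∀
  nonneg-gap : ∀ A B → A + B ≡ 0ℤ + (B + B + + 1 + (A - (+ 1 + B)))
  nonneg-gap = solve-∀
  below-gap : ∀ K A B → K * A ≡ + 1 + (A + B) + ((K - + 2) * A + (A - (+ 1 + B)))
  below-gap = solve-∀
  ratio-gap : ∀ K A B t → (+ 2 * t) * (K * A - (A + B))
            ≡ K * A + ((K - + 2) * A * (+ 2 * (t - + 1) + + 1) + + 2 * (t * (A - B) - A))
  ratio-gap = solve-∀
  t : ℤ
  t = + (2 ^ n)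
  0≤B : 0ℤ ≤ B
  0≤B = tails-nonneg bounds
  0≤c : 0ℤ ≤ A - (+ 1 + B)
  0≤c = gap< (tails-below bounds)
  0≤r : 0ℤ ≤ t * (A - B) - A
  0≤r = i≤j⇒0≤j-i (ratio-bound bounds)
  0≤u : 0ℤ ≤ K - + 2
  0≤u = i≤j⇒0≤j-i 2≤K
  0≤t-1 : 0ℤ ≤ t - + 1
  0≤t-1 = i≤j⇒0≤j-i (+≤+ (ℕ.m^n>0 2 n))
  0≤A : 0ℤ ≤ A
  0≤A = ≤-byGap _ (A-gap A B) (+-mono-≤ (+-mono-≤ 0≤B (0≤+ 1)) 0≤c)

prodFromTo-factors : ∀ k j e n → j ℕ.+ n ≡ ℕ.suc e → prodFromTo k j e ≡ prodN k j n
prodFromTo-factors k j e n j+n≡1+e =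
  cong (prodN k j) (subst (λ m → m ℕ.∸ j ≡ n) j+n≡1+e (ℕ.m+n∸m≡n j n))

sumN-split : ∀ k e j n → j ℕ.+ ℕ.suc n ≡ ℕ.suc e →
             sumN k e j (ℕ.suc n) ≡ prodN k j (ℕ.suc n) + sumN k e (ℕ.suc j) n
sumN-split k e j n j+n≡1+e = cong (_+ sumN k e (ℕ.suc j) n) (prodFromTo-factors k j e (ℕ.suc n) j+n≡1+e)

-- Every tail k_j⋯k_e (with 1 ≤ j ≤ e, m + 1 factors) satisfies the bounds,
-- the sum being taken over its proper tails k_{j'}⋯k_e, j < j' ≤ e.
tailBounds : ∀ e (k : ℕ → ℤ) → (∀ i → 1 ℕ.≤ i → i ℕ.≤ e → + 2 ≤ k i) →
             ∀ m j → 1 ℕ.≤ j → j ℕ.+ m ≡ e →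
             TailBounds (ℕ.suc m) (prodN k j (ℕ.suc m)) (sumN k e (ℕ.suc j) m)
tailBounds e k k≥2 m j 1≤j j+m≡e with k≥2 j 1≤j (subst (j ℕ.≤_) j+m≡e (ℕ.m≤m+n j m))
tailBounds e k k≥2 ℕ.zero j 1≤j j+m≡e | 2≤kⱼ = tailBounds-one 2≤kⱼ
tailBounds e k k≥2 (ℕ.suc m) j 1≤j j+m≡e | 2≤kⱼ =
  subst (TailBounds (ℕ.suc (ℕ.suc m)) (prodN k j (ℕ.suc (ℕ.suc m))))
        (sym (sumN-split k e (ℕ.suc j) m (cong ℕ.suc j+m≡e)))
        (tailBounds-step 2≤kⱼ (tailBounds e k k≥2 m (ℕ.suc j) (ℕ.s≤s ℕ.z≤n) j+1+m≡e))
  where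
  j+1+m≡e : ℕ.suc j ℕ.+ m ≡ e
  j+1+m≡e = trans (sym (ℕ.+-suc j m)) j+m≡e

no-small-multiple : ∀ {d x} → 0ℤ < x → x < d → ¬ (d ∣ x)
no-small-multiple (+<+ {n = ℕ.suc _} _) (+<+ x<d) = >⇒∤ x<d

divides-linear : ∀ A B p → (A * p - B) ∣ (p * p + p + + 1) → (A * p - B) ∣ (B * p + A + B)
divides-linear A B p d∣N =
  Signed.∣⇒∣ᵤ (subst (A * p - B Signed.∣_) (eliminate A B p)
    (Signed.∣m∣n⇒∣m-n (Signed.∣n⇒∣m*n A (Signed.∣ᵤ⇒∣ d∣N)) (Signed.∣n⇒∣m*n (p + + 1) Signed.∣-refl)))
  where
  eliminate : ∀ A B p → A * (p * p + p + + 1) - (p + + 1) * (A * p - B) ≡ B * p + A + B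
  eliminate = solve-∀

-- For p ≥ 3·2ⁿ the linear combination B·p + A + B lies strictly between 0
-- and A·p − B, so A·p − B cannot divide p² + p + 1.
not-divisor : ∀ {n A B} p → TailBounds n A B → + (3 ℕ.* 2 ^ n) ≤ p →
              ¬ ((A * p - B) ∣ (p * p + p + + 1))
not-divisor {n} {A} {B} p bounds p≥3t d∣N =
  no-small-multiple (<-byGap _ (positive-gap A B p t) 0≤positive-gap)
                    (<-byGap _ (below-gap A B p t) 0≤below-gap)
                    (divides-linear A B p d∣N)
  where
  -- The certificates use the gaps c = A − B − 1, r = 2ⁿ(A − B) − A and
  -- q = p − 3·2ⁿ, all nonnegative.
  positive-gap : ∀ A B p t → B * p + A + B ≡ + 1 + 0ℤ
                   + (B * (+ 3 * t + (p - + 3 * t)) + B + B + (A - (+ 1 + B)))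
  positive-gap = solve-∀
  below-gap : ∀ A B p t → A * p - B ≡ + 1 + (B * p + A + B)
                + (+ 2 * (A - (+ 1 + B)) + + 1 + + 3 * (t * (A - B) - A)
                   + (A - (+ 1 + B) + + 1) * (p - + 3 * t))
  below-gap = solve-∀
  t : ℤ
  t = + (2 ^ n)
  0≤B : 0ℤ ≤ B
  0≤B = tails-nonneg bounds
  0≤c : 0ℤ ≤ A - (+ 1 + B)
  0≤c = gap< (tails-below bounds)
  0≤r : 0ℤ ≤ t * (A - B) - A
  0≤r = i≤j⇒0≤j-i (ratio-bound bounds)
  0≤q : 0ℤ ≤ p - + 3 * t
  0≤q = i≤j⇒0≤j-i (subst (_≤ p) (pos-* 3 (2 ^ n)) p≥3t)
  0≤positive-gap : 0ℤ ≤ B * (+ 3 * t + (p - + 3 * t)) + B + B + (A - (+ 1 + B))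
  0≤positive-gap = +-mono-≤ (+-mono-≤ (+-mono-≤ (0≤-* 0≤B 0≤p) 0≤B) 0≤B) 0≤c
    where
    0≤p : 0ℤ ≤ + 3 * t + (p - + 3 * t)
    0≤p = +-mono-≤ (0≤-* (0≤+ 3) (0≤+ (2 ^ n))) 0≤q
  0≤below-gap : 0ℤ ≤ + 2 * (A - (+ 1 + B)) + + 1 + + 3 * (t * (A - B) - A)
                       + (A - (+ 1 + B) + + 1) * (p - + 3 * t)
  0≤below-gap = +-mono-≤ (+-mono-≤ (+-mono-≤ (0≤-* (0≤+ 2) 0≤c) (0≤+ 1)) (0≤-* (0≤+ 3) 0≤r))
                         (0≤-* (+-mono-≤ 0≤c (0≤+ 1)) 0≤q)

lemma5 : (e : ℕ) → 1 Data.Nat.≤ e → (k : ℕ → ℤ) →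
         (∀ i → 1 Data.Nat.≤ i → i Data.Nat.≤ e → + 2 ≤ k i) →
         (p : ℤ) → + (3 Data.Nat.* (2 ^ e)) ≤ p →
         ¬ ((Aof k e * p - Bof k e) ∣ (p * p + p + + 1))
lemma5 (ℕ.suc e) _ k k≥2 p p≥3·2ᵉ =
  not-divisor p (tailBounds (ℕ.suc e) k k≥2 e 1 (ℕ.s≤s ℕ.z≤n) refl) p≥3·2ᵉ
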